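{- Let $G$ be a graph that has a unique $L_{2,t}(G)$-set $B$. Then every leaf of $G$ belongs to $B$.
   Context: All graphs are finite and simple; a leaf is a vertex of degree $1$. $N(v)$ denotes the open neighborhood of $v$. A set $B\subseteq V(G)$ is a $2$-total limited packing set if $|B\cap N(v)|\leq 2$ for every $v\in V(G)$; $L_{2,t}(G)$ is the maximum cardinality of such a set, and an $L_{2,t}(G)$-set is a $2$-total limited packing set of cardinality $L_{2,t}(G)$. -}

module Defs where

open import Data.Nat using (ℕ; _≤_)
open import Data.Bool using (Bool; true; false)
open import Data.Fin using (Fin)
open import Data.Fin.Subset using (Subset; _∩_; ∣_∣)
open import Data.Vec using (tabulate)
open import Relation.Binary.PropositionalEquality using (_≡_)

record Graph (n : ℕ) : Set where
  field
    adj   : Fin n → Fin n → Bool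
    sym   : ∀ u v → adj u v ≡ adj v u
    irrefl : ∀ v → adj v v ≡ false

open Graph public

N : ∀ {n} → Graph n → Fin n → Subset n
N G v = tabulate (λ u → adj G v u)

degree : ∀ {n} → Graph n → Fin n → ℕ
degree G v = ∣ N G v ∣

IsLeaf : ∀ {n} → Graph n → Fin n → Set
IsLeaf G v = degree G v ≡ 1

Is2TLP : ∀ {n} → Graph n → Subset n → Set
Is2TLP G B = ∀ v → ∣ B ∩ N G v ∣ ≤ 2

IsL2tSet : ∀ {n} → Graph n → Subset n → Set
IsL2tSet G B = Is2TLP G B × (∀ B' → Is2TLP G B' → ∣ B' ∣ ≤ ∣ B ∣)
  where open import Data.Product using (_×_)

IsUniqueL2tSet : ∀ {n} → Graph n → Subset n → Set
IsUniqueL2tSet G B = IsL2tSet G B × (∀ B' → IsL2tSet G B' → B' ≡ B)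
  where open import Data.Product using (_×_)

-- Suppose the leaf v, with unique neighbour u, is not in the unique
-- L_{2,t}-set B. Only N(u) contains v, so adding v to B affects only the
-- count at u. If B ∩ N(u) is empty, B ∪ {v} is a larger packing; otherwise
-- swapping some x ∈ B ∩ N(u) for v gives a second maximum packing.
module Submission where

open import Defs
open import Data.Nat using (ℕ; suc; _≤_)
open import Data.Nat.Properties using (≤-trans; ≤-reflexive; <⇒≱; n≤1+n; suc-injective)
open import Data.Fin using (Fin; zero; suc; _≟_)
open import Data.Fin.Subset
  using (Subset; _∈_; _∉_; _⊆_; _∩_; _∪_; _-_; ⁅_⁆; ⊥; ∣_∣; inside; outside; Empty)
open import Data.Fin.Subset.Properties
  using (_∈?_; nonempty?; x∈⁅x⁆; x∈⁅y⁆⇒x≡y; ∣⁅x⁆∣≡1; p⊆q⇒∣p∣≤∣q∣; ∪-identityʳ; p─⊥≡p;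
         x∈p∩q⁺; x∈p∩q⁻; x∈p∪q⁺; x∈p∪q⁻; p∩q⊆p; p─q⊆p; x∈p∧x≢y⇒x∈p-y)
open import Data.Vec using ([]; _∷_; lookup; here; there)
open import Data.Vec.Properties using ([]=⇒lookup; lookup⇒[]=; lookup∘tabulate)
open import Data.Product using (∃; _,_)
open import Data.Sum using (inj₁; inj₂)
open import Function using (id; _∘_)
open import Relation.Nullary using (yes; no; contradiction)
open import Relation.Binary.PropositionalEquality
  using (_≡_; refl; cong; subst; trans; module ≡-Reasoning) renaming (sym to ≡-sym)

private
  variable
    n : ℕ

∣p∣≡0⇒p≡⊥ : (p : Subset n) → ∣ p ∣ ≡ 0 → p ≡ ⊥
∣p∣≡0⇒p≡⊥ []            _     = refl
∣p∣≡0⇒p≡⊥ (outside ∷ p) ∣p∣≡0 = cong (outside ∷_) (∣p∣≡0⇒p≡⊥ p ∣p∣≡0)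

∣p∣≡1⇒p≡⁅x⁆ : (p : Subset n) → ∣ p ∣ ≡ 1 → ∃ λ x → p ≡ ⁅ x ⁆
∣p∣≡1⇒p≡⁅x⁆ (inside ∷ p)  ∣p∣≡1 = zero , cong (inside ∷_) (∣p∣≡0⇒p≡⊥ p (suc-injective ∣p∣≡1))
∣p∣≡1⇒p≡⁅x⁆ (outside ∷ p) ∣p∣≡1 with ∣p∣≡1⇒p≡⁅x⁆ p ∣p∣≡1
... | x , refl = suc x , refl

x∉p-x : (p : Subset n) (x : Fin n) → x ∉ p - x
x∉p-x (_ ∷ p) zero    ()
x∉p-x (_ ∷ p) (suc x) (there x∈p-x) = x∉p-x p x x∈p-x

x∉p⇒∣p∪⁅x⁆∣≡1+∣p∣ : {x : Fin n} (p : Subset n) → x ∉ p → ∣ p ∪ ⁅ x ⁆ ∣ ≡ suc ∣ p ∣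
x∉p⇒∣p∪⁅x⁆∣≡1+∣p∣ {x = zero}  (inside  ∷ p) x∉p = contradiction here x∉p
x∉p⇒∣p∪⁅x⁆∣≡1+∣p∣ {x = zero}  (outside ∷ p) _   = cong (suc ∘ ∣_∣) (∪-identityʳ p)
x∉p⇒∣p∪⁅x⁆∣≡1+∣p∣ {x = suc x} (inside  ∷ p) x∉p = cong suc (x∉p⇒∣p∪⁅x⁆∣≡1+∣p∣ p (x∉p ∘ there))
x∉p⇒∣p∪⁅x⁆∣≡1+∣p∣ {x = suc x} (outside ∷ p) x∉p = x∉p⇒∣p∪⁅x⁆∣≡1+∣p∣ p (x∉p ∘ there)

x∈p⇒1+∣p-x∣≡∣p∣ : {x : Fin n} (p : Subset n) → x ∈ p → suc ∣ p - x ∣ ≡ ∣ p ∣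
x∈p⇒1+∣p-x∣≡∣p∣ (inside  ∷ p) here        = cong (suc ∘ ∣_∣) (p─⊥≡p p)
x∈p⇒1+∣p-x∣≡∣p∣ (inside  ∷ p) (there x∈p) = cong suc (x∈p⇒1+∣p-x∣≡∣p∣ p x∈p)
x∈p⇒1+∣p-x∣≡∣p∣ (outside ∷ p) (there x∈p) = x∈p⇒1+∣p-x∣≡∣p∣ p x∈p

∣p-x∪⁅y⁆∣≡∣p∣ : {x y : Fin n} (p : Subset n) → x ∈ p → y ∉ p → ∣ (p - x) ∪ ⁅ y ⁆ ∣ ≡ ∣ p ∣
∣p-x∪⁅y⁆∣≡∣p∣ {x = x} p x∈p y∉p =
  trans (x∉p⇒∣p∪⁅x⁆∣≡1+∣p∣ (p - x) (y∉p ∘ p─q⊆p p ⁅ x ⁆)) (x∈p⇒1+∣p-x∣≡∣p∣ p x∈p)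

∈N-sym : (G : Graph n) {v w : Fin n} → v ∈ N G w → w ∈ N G v
∈N-sym G {v} {w} v∈Nw = lookup⇒[]= w (N G v) (begin
  lookup (N G v) w  ≡⟨ lookup∘tabulate (adj G v) w ⟩
  adj G v w         ≡⟨ Graph.sym G v w ⟩
  adj G w v         ≡⟨ lookup∘tabulate (adj G w) v ⟨
  lookup (N G w) v  ≡⟨ []=⇒lookup v∈Nw ⟩
  inside            ∎)
  where open ≡-Reasoning

leaf-neighbour-unique : (G : Graph n) {u v w : Fin n} → N G v ≡ ⁅ u ⁆ → v ∈ N G w → w ≡ u
leaf-neighbour-unique G {u} {w = w} Nv≡⁅u⁆ v∈Nw = x∈⁅y⁆⇒x≡y u (subst (w ∈_) Nv≡⁅u⁆ (∈N-sym G v∈Nw))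

module LeafExtension (G : Graph n) (B : Subset n) (packing : Is2TLP G B)
                     {u v : Fin n} (Nv≡⁅u⁆ : N G v ≡ ⁅ u ⁆) where

  packing-⊆-∪leaf : {C : Subset n} → C ⊆ B ∪ ⁅ v ⁆ → ∣ C ∩ N G u ∣ ≤ 2 → Is2TLP G C
  packing-⊆-∪leaf {C} C⊆B∪v bound w with w ≟ u
  ... | yes refl = bound
  ... | no w≢u   = ≤-trans (p⊆q⇒∣p∣≤∣q∣ C∩Nw⊆B∩Nw) (packing w)
    where
    C∩Nw⊆B∩Nw : C ∩ N G w ⊆ B ∩ N G w
    C∩Nw⊆B∩Nw y∈C∩Nw with x∈p∩q⁻ C (N G w) y∈C∩Nw
    ... | y∈C , y∈Nw with x∈p∪q⁻ B ⁅ v ⁆ (C⊆B∪v y∈C)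
    ... | inj₁ y∈B = x∈p∩q⁺ (y∈B , y∈Nw)
    ... | inj₂ y∈⁅v⁆ with x∈⁅y⁆⇒x≡y v y∈⁅v⁆
    ... | refl = contradiction (leaf-neighbour-unique G Nv≡⁅u⁆ y∈Nw) w≢u

  add-leaf : Empty (B ∩ N G u) → Is2TLP G (B ∪ ⁅ v ⁆)
  add-leaf empty = packing-⊆-∪leaf id
    (≤-trans (p⊆q⇒∣p∣≤∣q∣ ⊆⁅v⁆) (≤-trans (≤-reflexive (∣⁅x⁆∣≡1 v)) (n≤1+n 1)))
    where
    ⊆⁅v⁆ : (B ∪ ⁅ v ⁆) ∩ N G u ⊆ ⁅ v ⁆
    ⊆⁅v⁆ {y} y∈ with x∈p∩q⁻ (B ∪ ⁅ v ⁆) (N G u) y∈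
    ... | y∈B∪v , y∈Nu with x∈p∪q⁻ B ⁅ v ⁆ y∈B∪v
    ... | inj₁ y∈B   = contradiction (y , x∈p∩q⁺ (y∈B , y∈Nu)) empty
    ... | inj₂ y∈⁅v⁆ = y∈⁅v⁆

  swap-leaf : {x : Fin n} → x ∈ B ∩ N G u → v ∉ B → Is2TLP G ((B - x) ∪ ⁅ v ⁆)
  swap-leaf {x} x∈B∩Nu v∉B = packing-⊆-∪leaf ⊆B∪v
    (≤-trans (p⊆q⇒∣p∣≤∣q∣ ⊆swap)
    (≤-trans (≤-reflexive (∣p-x∪⁅y⁆∣≡∣p∣ (B ∩ N G u) x∈B∩Nu (v∉B ∘ p∩q⊆p B (N G u))))
             (packing u)))
    where
    ⊆B∪v : (B - x) ∪ ⁅ v ⁆ ⊆ B ∪ ⁅ v ⁆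
    ⊆B∪v y∈ with x∈p∪q⁻ (B - x) ⁅ v ⁆ y∈
    ... | inj₁ y∈B-x = x∈p∪q⁺ (inj₁ (p─q⊆p B ⁅ x ⁆ y∈B-x))
    ... | inj₂ y∈⁅v⁆ = x∈p∪q⁺ (inj₂ y∈⁅v⁆)
    ⊆swap : ((B - x) ∪ ⁅ v ⁆) ∩ N G u ⊆ ((B ∩ N G u) - x) ∪ ⁅ v ⁆
    ⊆swap {y} y∈ with x∈p∩q⁻ ((B - x) ∪ ⁅ v ⁆) (N G u) y∈
    ... | y∈B-x∪v , y∈Nu with x∈p∪q⁻ (B - x) ⁅ v ⁆ y∈B-x∪v
    ... | inj₂ y∈⁅v⁆ = x∈p∪q⁺ (inj₂ y∈⁅v⁆)
    ... | inj₁ y∈B-x with y ≟ x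
    ...   | yes refl = contradiction y∈B-x (x∉p-x B x)
    ...   | no y≢x   = x∈p∪q⁺ (inj₁ (x∈p∧x≢y⇒x∈p-y (x∈p∩q⁺ (p─q⊆p B ⁅ x ⁆ y∈B-x , y∈Nu)) y≢x))

L2t-of-equal-size : (G : Graph n) (B C : Subset n) →
                    IsL2tSet G B → Is2TLP G C → ∣ C ∣ ≡ ∣ B ∣ → IsL2tSet G C
L2t-of-equal-size G B C (_ , maximal) packing ∣C∣≡∣B∣ =
  packing , λ B' packing' → ≤-trans (maximal B' packing') (≤-reflexive (≡-sym ∣C∣≡∣B∣))

mainTheorem10 : ∀ {n : ℕ} (G : Graph n) (B : Subset n) →
    IsUniqueL2tSet G B → ∀ (v : Fin n) → IsLeaf G v → v ∈ B
mainTheorem10 G B (L2t@(packing , maximal) , unique) v leaf with v ∈? B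
... | yes v∈B = v∈B
... | no  v∉B with ∣p∣≡1⇒p≡⁅x⁆ (N G v) leaf
... | u , Nv≡⁅u⁆ with nonempty? (B ∩ N G u)
...   | no empty =
  contradiction (maximal (B ∪ ⁅ v ⁆) (add-leaf empty))
                (<⇒≱ (≤-reflexive (≡-sym (x∉p⇒∣p∪⁅x⁆∣≡1+∣p∣ B v∉B))))
  where open LeafExtension G B packing Nv≡⁅u⁆
...   | yes (x , x∈B∩Nu) =
  subst (v ∈_) (unique C L2t-C) (x∈p∪q⁺ (inj₂ (x∈⁅x⁆ v)))
  where
  open LeafExtension G B packing Nv≡⁅u⁆
  C : Subset _
  C = (B - x) ∪ ⁅ v ⁆
  L2t-C : IsL2tSet G C
  L2t-C = L2t-of-equal-size G B C L2t (swap-leaf x∈B∩Nu v∉B)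
            (∣p-x∪⁅y⁆∣≡∣p∣ B (p∩q⊆p B (N G u) x∈B∩Nu) v∉B)
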